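{- Let $G$ be a bridgeless graph and let $d\ge2$ be an integer. Let $P\in\mathbb{R}^d$ be any nonzero vector and let $P_1,P_2\in\mathbb{R}^d$ be any two non-collinear vectors. Then: (1) $G$ admits a nowhere-zero $2$-flow if and only if it admits a vector $\{P\}$-flow; (2) $G$ admits a nowhere-zero $3$-flow if and only if it admits a vector $\{P_1,P_2,P_1+P_2\}$-flow; (3) $G$ admits a nowhere-zero $4$-flow if and only if it admits a vector $\{P_1,P_2,P_1+P_2,P_1-P_2\}$-flow.
   Context: All graphs are finite and may have multiple edges but no loops. A nowhere-zero $k$-flow of $G$ is a pair $(D,f)$ with $D$ an orientation and $f:E(G)\to\mathbb{Z}$, $0<|f(e)|<k$, satisfying flow conservation at every vertex. For an orientation $D$ and vertex $v$, $E_D^+(v)$, $E_D^-(v)$ are the out- and in-edges. For $\Omega\subseteq\mathbb{R}^d$, a vector $\Omega$-flow of $G$ is a pair $(D,f)$ with $D$ an orientation of $G$ and $f:E(G)\to\Omega$ satisfying $\sum_{e\in E_D^+(v)}f(e)-\sum_{e\in E_D^-(v)}f(e)=\mathbf{0}$ at every vertex $v$. -}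

module Defs where

open import Level using (Level; suc; _⊔_)
open import Data.Nat as ℕ using (ℕ)
open import Data.Fin using (Fin; _≟_)
open import Data.Bool using (Bool; true; false; if_then_else_)
open import Data.Integer as ℤ using (ℤ; ∣_∣)
open import Data.Product using (Σ; ∃; _×_; _,_)
open import Data.Sum using (_⊎_)
open import Relation.Nullary using (¬_; does)
open import Relation.Binary.PropositionalEquality using (_≡_; _≢_)
open import Relation.Binary.Structures using (IsTotalOrder)
open import Algebra.Bundles using (CommutativeRing)

-- The real numbers, axiomatised as a complete ordered field
-- (any two such are isomorphic, so quantifying over all of them is
-- the same as speaking about ℝ).

record RealField c ℓ : Set (suc (c ⊔ ℓ)) where
  field
    commRing : CommutativeRing c ℓ
  open CommutativeRing commRing public
  field
    _≤_         : Carrier → Carrier → Set ℓ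
    isTotalOrder : IsTotalOrder _≈_ _≤_
    0≉1         : ¬ (0# ≈ 1#)
    +-monoˡ-≤   : ∀ {x y} z → x ≤ y → (x + z) ≤ (y + z)
    *-nonneg    : ∀ {x y} → 0# ≤ x → 0# ≤ y → 0# ≤ (x * y)
    inverse     : ∀ x → ¬ (x ≈ 0#) → ∃ λ y → (x * y) ≈ 1#
    lub : (S : Carrier → Set (c ⊔ ℓ)) → ∃ S →
          (∃ λ b → ∀ x → S x → x ≤ b) →
          ∃ λ s → (∀ x → S x → x ≤ s) × (∀ b → (∀ x → S x → x ≤ b) → s ≤ b)

record Graph : Set where
  field
    n m    : ℕ
    end₁   : Fin m → Fin n
    end₂   : Fin m → Fin n
    noLoop : ∀ e → end₁ e ≢ end₂ e
open Graph public

Joins : (G : Graph) → Fin (m G) → Fin (n G) → Fin (n G) → Set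
Joins G e' u w = (end₁ G e' ≡ u × end₂ G e' ≡ w) ⊎ (end₂ G e' ≡ u × end₁ G e' ≡ w)

data Reach (G : Graph) (e : Fin (m G)) (u : Fin (n G)) : Fin (n G) → Set where
  here : Reach G e u u
  step : ∀ {v w} (e' : Fin (m G)) → e' ≢ e → Reach G e u v → Joins G e' v w → Reach G e u w

IsBridge : (G : Graph) → Fin (m G) → Set
IsBridge G e = ¬ Reach G e (end₁ G e) (end₂ G e)

Bridgeless : Graph → Set
Bridgeless G = ∀ e → ¬ IsBridge G e

Orientation : Graph → Set
Orientation G = Fin (m G) → Bool

tail head : (G : Graph) → Orientation G → Fin (m G) → Fin (n G)
tail G D e = if D e then end₁ G e else end₂ G e
head G D e = if D e then end₂ G e else end₁ G e

sumℤ : ∀ {k} → (Fin k → ℤ) → ℤ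
sumℤ {ℕ.zero}  f = ℤ.+ 0
sumℤ {ℕ.suc k} f = f Fin.zero ℤ.+ sumℤ (λ i → f (Fin.suc i))
  where import Data.Fin as Fin

netℤ : (G : Graph) → Orientation G → (Fin (m G) → ℤ) → Fin (n G) → ℤ
netℤ G D f v =
  sumℤ (λ e → if does (tail G D e ≟ v) then f e else ℤ.+ 0)
  ℤ.- sumℤ (λ e → if does (head G D e ≟ v) then f e else ℤ.+ 0)

IsNZFlow : (k : ℕ) (G : Graph) → Orientation G → (Fin (m G) → ℤ) → Set
IsNZFlow k G D f =
  (∀ e → 0 ℕ.< ∣ f e ∣ × ∣ f e ∣ ℕ.< k) × (∀ v → netℤ G D f v ≡ ℤ.+ 0)

HasNZFlow : ℕ → Graph → Set
HasNZFlow k G = Σ (Orientation G) λ D → Σ (Fin (m G) → ℤ) λ f → IsNZFlow k G D f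

module _ {c ℓ} (R : RealField c ℓ) where
  open RealField R

  Vecᴿ : ℕ → Set c
  Vecᴿ d = Fin d → Carrier

  _≈ᵛ_ : ∀ {d} → Vecᴿ d → Vecᴿ d → Set ℓ
  x ≈ᵛ y = ∀ i → x i ≈ y i

  0ᵛ : ∀ {d} → Vecᴿ d
  0ᵛ _ = 0#

  _+ᵛ_ _-ᵛ_ : ∀ {d} → Vecᴿ d → Vecᴿ d → Vecᴿ d
  (x +ᵛ y) i = x i + y i
  (x -ᵛ y) i = x i - y i

  _·ᵛ_ : ∀ {d} → Carrier → Vecᴿ d → Vecᴿ d
  (a ·ᵛ x) i = a * x i

  NonzeroVec : ∀ {d} → Vecᴿ d → Set ℓ
  NonzeroVec x = ¬ (x ≈ᵛ 0ᵛ)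

  NonCollinear : ∀ {d} → Vecᴿ d → Vecᴿ d → Set (c ⊔ ℓ)
  NonCollinear P₁ P₂ = ∀ a b → ((a ·ᵛ P₁) +ᵛ (b ·ᵛ P₂)) ≈ᵛ 0ᵛ → (a ≈ 0#) × (b ≈ 0#)

  sumᴿ : ∀ {k} → (Fin k → Carrier) → Carrier
  sumᴿ {ℕ.zero}  f = 0#
  sumᴿ {ℕ.suc k} f = f Fin.zero + sumᴿ (λ i → f (Fin.suc i))
    where import Data.Fin as Fin

  netᴿ : ∀ {d} (G : Graph) → Orientation G → (Fin (m G) → Vecᴿ d) → Fin (n G) → Vecᴿ d
  netᴿ G D f v i =
    sumᴿ (λ e → if does (tail G D e ≟ v) then f e i else 0#)
    - sumᴿ (λ e → if does (head G D e ≟ v) then f e i else 0#)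

  IsVecFlow : ∀ {d} → (Vecᴿ d → Set ℓ) → (G : Graph) → Orientation G → (Fin (m G) → Vecᴿ d) → Set ℓ
  IsVecFlow Ω G D f = (∀ e → Ω (f e)) × (∀ v → netᴿ G D f v ≈ᵛ 0ᵛ)

  HasVecFlow : ∀ {d} → (Vecᴿ d → Set ℓ) → Graph → Set (c ⊔ ℓ)
  HasVecFlow Ω G = Σ (Orientation G) λ D → Σ (Fin (m G) → Vecᴿ _) λ f → IsVecFlow Ω G D f

  Ω₁ : ∀ {d} → Vecᴿ d → Vecᴿ d → Set ℓ
  Ω₁ P x = x ≈ᵛ P

  Ω₃ : ∀ {d} → Vecᴿ d → Vecᴿ d → Vecᴿ d → Set ℓ
  Ω₃ P₁ P₂ x = x ≈ᵛ P₁ ⊎ x ≈ᵛ P₂ ⊎ x ≈ᵛ (P₁ +ᵛ P₂)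

  Ω₄ : ∀ {d} → Vecᴿ d → Vecᴿ d → Vecᴿ d → Set ℓ
  Ω₄ P₁ P₂ x = x ≈ᵛ P₁ ⊎ x ≈ᵛ P₂ ⊎ x ≈ᵛ (P₁ +ᵛ P₂) ⊎ x ≈ᵛ (P₁ -ᵛ P₂)

{-# OPTIONS --safe #-}
module Submission where

-- An integer flow with values in {0, ±1} is an Eulerian orientation of its support, and every
-- even subgraph b has one.  Take a non-loop edge i : u → w of b; as w has even degree there is
-- another non-loop edge j of b joining w to some x.  Redirect i to u → x and turn j into a loop:
-- b stays even and has fewer non-loop edges, and a flow for the new graph becomes one for the
-- old by letting j carry the value of i from w to x.
-- Applied to the odd edges of an integer flow g, this rounds g to a flow a ∈ {0, ±1} with
-- a ≡ g (mod 2), and then (g - a)/2 is a flow too.  For a nowhere-zero 3-flow g, the flows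
-- p = (g - a)/2 and q = p + a satisfy ±(p, q) ∈ {(1,0), (0,1), (1,1)}; for a nowhere-zero
-- 4-flow, p = a and q = the rounding of (g - a)/2 satisfy ±(p, q) ∈ {(1,0), (0,1), (1,1), (1,-1)}.
-- Reversing the edges where the sign is -, e ↦ p P₁ + q P₂ becomes a vector flow with values in
-- Ω.  Conversely, the values of an Ω-flow are p P₁ + q P₂ with (p, q) in these sets and its net
-- outflow is (net p) P₁ + (net q) P₂, so non-collinearity (and characteristic 0) makes p and q
-- flows; then p + q, resp. p + 2q, is the nowhere-zero 3-, resp. 4-flow.  The 2-flow case is
-- the same argument with P₁ = P₂ = P and q = 0.

open import Defs
open import Data.Nat using (ℕ; _≤_)
open import Data.Product using (_×_)
open import Function.Bundles using (_⇔_)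

open import Algebra.Bundles using (AbelianGroup; CommutativeRing; Ring)
open import Algebra.Morphism.Structures using (module GroupMorphisms)
open import Data.Bool using (Bool; true; false; if_then_else_)
open import Data.Fin using (Fin; zero; suc; _≟_; punchIn; punchOut)
open import Data.Fin.Properties using (punchInᵢ≢i; punchIn-injective; punchIn-punchOut)
open import Data.Integer as ℤ using (ℤ; +_; -[1+_]; _⊖_)
open import Data.Integer.Properties using (+-0-abelianGroup)
open import Data.Nat as ℕ using (zero; suc)
open import Data.Product using (Σ; _,_; proj₁; proj₂)
open import Data.Sum using (_⊎_; inj₁; inj₂)
open import Data.Vec.Functional using (removeAt; updateAt)
open import Data.Vec.Functional.Properties using (updateAt-updates; updateAt-minimal)
open import Function using (_∘_; const)
open import Relation.Binary.PropositionalEquality as ≡ using (_≡_; _≢_)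
open import Relation.Nullary using (does)
open import Relation.Nullary.Decidable using (dec-false)

module AdditiveNotation {a ℓ} (A : AbelianGroup a ℓ) where
  open AbelianGroup A public
    renaming ( _∙_ to infixl 6 _+_; ε to 0#; _⁻¹ to infix 8 -_
             ; ∙-cong to +-cong; ∙-congˡ to +-congˡ; ∙-congʳ to +-congʳ; ⁻¹-cong to -‿cong
             ; assoc to +-assoc; comm to +-comm; identityˡ to +-identityˡ; identityʳ to +-identityʳ
             ; inverseˡ to -‿inverseˡ; inverseʳ to -‿inverseʳ )
  open import Algebra.Properties.AbelianGroup A public
    using (x∙y⁻¹≈ε⇒x≈y; x≈y⇒x∙y⁻¹≈ε)
    renaming (ε⁻¹≈ε to -0#≈0#; ⁻¹-∙-comm to -‿+-comm; ⁻¹-involutive to -‿involutive)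
  open import Algebra.Properties.CommutativeSemigroup commutativeSemigroup public using (interchange)

module FinSum {a ℓ} (A : AbelianGroup a ℓ) where
  open AdditiveNotation A
  open import Algebra.Properties.CommutativeMonoid.Sum commutativeMonoid public
    using (sum; sum-cong-≋; ∑-distrib-+)
  open import Algebra.Properties.CommutativeMonoid.Sum commutativeMonoid
    using (sum-remove; sum-replicate-zero)
  open import Relation.Binary.Reasoning.Setoid setoid

  sum-zero : ∀ {n} {f : Fin n → Carrier} → (∀ k → f k ≈ 0#) → sum f ≈ 0#
  sum-zero {n} vanish = trans (sum-cong-≋ vanish) (sum-replicate-zero n)

  sum-single : ∀ {n} {f : Fin n → Carrier} i → (∀ k → k ≢ i → f k ≈ 0#) → sum f ≈ f i
  sum-single {suc n} {f} i vanish = begin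
    sum f                     ≈⟨ sum-remove {i = i} f ⟩
    f i + sum (removeAt f i)  ≈⟨ +-congˡ (sum-zero λ k → vanish (punchIn i k) (punchInᵢ≢i i k)) ⟩
    f i + 0#                  ≈⟨ +-identityʳ (f i) ⟩
    f i                       ∎

  sum-pair : ∀ {n} {f : Fin n → Carrier} {i j} → i ≢ j →
             (∀ k → k ≢ i → k ≢ j → f k ≈ 0#) → sum f ≈ f i + f j
  sum-pair {suc n} {f} {i} {j} i≢j vanish = begin
    sum f                               ≈⟨ sum-remove {i = i} f ⟩
    f i + sum (removeAt f i)            ≈⟨ +-congˡ (sum-single (punchOut i≢j) vanish′) ⟩
    f i + f (punchIn i (punchOut i≢j))  ≡⟨ ≡.cong (λ k → f i + f k) (punchIn-punchOut i≢j) ⟩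
    f i + f j                           ∎
    where
    vanish′ : ∀ k → k ≢ punchOut i≢j → f (punchIn i k) ≈ 0#
    vanish′ k k≢ = vanish (punchIn i k) (punchInᵢ≢i i k) λ eq →
      k≢ (punchIn-injective i k _ (≡.trans eq (≡.sym (punchIn-punchOut i≢j))))

  sum-neg : ∀ {n} (f : Fin n → Carrier) → sum (λ k → - f k) ≈ - sum f
  sum-neg {zero}  f = sym -0#≈0#
  sum-neg {suc n} f = trans (+-congˡ (sum-neg (f ∘ suc))) (-‿+-comm (f zero) (sum (f ∘ suc)))

  sum-sub : ∀ {n} (f g : Fin n → Carrier) → sum (λ k → f k - g k) ≈ sum f - sum g
  sum-sub f g = trans (∑-distrib-+ f (λ k → - g k)) (+-congˡ (sum-neg g))

  sum-cong-except₂ : ∀ {n} {f g : Fin n → Carrier} {i j} → i ≢ j →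
                     (∀ k → k ≢ i → k ≢ j → f k ≈ g k) → f i + f j ≈ g i + g j → sum f ≈ sum g
  sum-cong-except₂ {f = f} {g} {i} {j} i≢j agree pair = x∙y⁻¹≈ε⇒x≈y _ _ (begin
    sum f - sum g                ≈⟨ sum-sub f g ⟨
    sum (λ k → f k - g k)        ≈⟨ sum-pair i≢j (λ k k≢i k≢j → x≈y⇒x∙y⁻¹≈ε (agree k k≢i k≢j)) ⟩
    (f i - g i) + (f j - g j)    ≈⟨ interchange (f i) (- g i) (f j) (- g j) ⟩
    (f i + f j) + (- g i - g j)  ≈⟨ +-congˡ (-‿+-comm (g i) (g j)) ⟩
    (f i + f j) - (g i + g j)    ≈⟨ x≈y⇒x∙y⁻¹≈ε pair ⟩
    0#                           ∎)

-- An edge u → x incident to w, read as an edge leaving w: its other end, and whether this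
-- reverses it.
far : ∀ {n} {u x w : Fin n} → u ≡ w ⊎ x ≡ w → Fin n
far {x = x} (inj₁ _) = x
far {u = u} (inj₂ _) = u

enters : ∀ {n} {u x w : Fin n} → u ≡ w ⊎ x ≡ w → Bool
enters (inj₁ _) = false
enters (inj₂ _) = true

-- Splitting off i and j at t i; j becomes a loop at s j.
split : ∀ {m n} (s t : Fin m → Fin n) (i j : Fin m) → s j ≡ t i ⊎ t j ≡ t i → Fin m → Fin n
split s t i j p = updateAt (updateAt t i (const (far p))) j (const (s j))

module _ {m n} (s t : Fin m → Fin n) {i j : Fin m} (p : s j ≡ t i ⊎ t j ≡ t i) where

  split-i : i ≢ j → split s t i j p i ≡ far p
  split-i i≢j = ≡.trans (updateAt-minimal i j _ i≢j) (updateAt-updates i t)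

  split-j : split s t i j p j ≡ s j
  split-j = updateAt-updates j _

  split-other : ∀ {e} → e ≢ i → e ≢ j → split s t i j p e ≡ t e
  split-other {e} e≢i e≢j = ≡.trans (updateAt-minimal e j _ e≢j) (updateAt-minimal e i t e≢i)

module Net {a ℓ} (A : AbelianGroup a ℓ) where
  open AdditiveNotation A
  open FinSum A
  open import Relation.Binary.Reasoning.Setoid setoid

  select : Bool → Carrier → Carrier
  select b x = if b then x else 0#

  signed : Bool → Carrier → Carrier
  signed σ x = if σ then - x else x

  edgeNet : ∀ {n} → Fin n → Fin n → Carrier → Fin n → Carrier
  edgeNet u w x v = select (does (u ≟ v)) x - select (does (w ≟ v)) x

  net : ∀ {m n} → (Fin m → Fin n) → (Fin m → Fin n) → (Fin m → Carrier) → Fin n → Carrier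
  net s t a v = sum (λ e → edgeNet (s e) (t e) (a e) v)

  select-cong : ∀ b {x y} → x ≈ y → select b x ≈ select b y
  select-cong true  x≈y = x≈y
  select-cong false _   = refl

  select-0# : ∀ b → select b 0# ≈ 0#
  select-0# true  = refl
  select-0# false = refl

  select-neg : ∀ b x → select b (- x) ≈ - select b x
  select-neg true  x = refl
  select-neg false x = sym -0#≈0#

  select-+ : ∀ b x y → select b (x + y) ≈ select b x + select b y
  select-+ true  x y = refl
  select-+ false x y = sym (+-identityʳ 0#)

  edgeNet-cong : ∀ {n} (u w : Fin n) {x y} v → x ≈ y → edgeNet u w x v ≈ edgeNet u w y v
  edgeNet-cong u w v x≈y = +-cong (select-cong _ x≈y) (-‿cong (select-cong _ x≈y))

  edgeNet-0# : ∀ {n} (u w v : Fin n) → edgeNet u w 0# v ≈ 0#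
  edgeNet-0# u w v = trans (+-cong (select-0# _) (-‿cong (select-0# _))) (-‿inverseʳ 0#)

  edgeNet-away : ∀ {n} {u w v : Fin n} x → u ≢ v → w ≢ v → edgeNet u w x v ≈ 0#
  edgeNet-away {u = u} {w} {v} x u≢v w≢v
    rewrite dec-false (u ≟ v) u≢v | dec-false (w ≟ v) w≢v = -‿inverseʳ 0#

  edgeNet-loop : ∀ {n} {u w : Fin n} x v → u ≡ w → edgeNet u w x v ≈ 0#
  edgeNet-loop x v ≡.refl = -‿inverseʳ _

  module _ {n} (u w : Fin n) (x : Carrier) (v : Fin n) where
    private
      U W : Carrier
      U = select (does (u ≟ v)) x
      W = select (does (w ≟ v)) x

    edgeNet-reverse : edgeNet w u (- x) v ≈ edgeNet u w x v
    edgeNet-reverse = begin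
      select _ (- x) - select _ (- x)  ≈⟨ +-cong (select-neg _ x) (-‿cong (select-neg _ x)) ⟩
      - W - - U                        ≈⟨ +-congˡ (-‿involutive U) ⟩
      - W + U                          ≈⟨ +-comm (- W) U ⟩
      U - W                            ∎

    edgeNet-neg : edgeNet u w (- x) v ≈ - edgeNet u w x v
    edgeNet-neg = begin
      select _ (- x) - select _ (- x)  ≈⟨ +-cong (select-neg _ x) (-‿cong (select-neg _ x)) ⟩
      - U - - W                        ≈⟨ -‿+-comm U (- W) ⟩
      - (U - W)                        ∎

    edgeNet-chain : ∀ z → edgeNet u w x v + edgeNet w z x v ≈ edgeNet u z x v
    edgeNet-chain z = begin
      (U - W) + (W - Z)    ≈⟨ +-assoc U (- W) (W - Z) ⟩
      U + (- W + (W - Z))  ≈⟨ +-congˡ (+-assoc (- W) W (- Z)) ⟨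
      U + ((- W + W) - Z)  ≈⟨ +-congˡ (+-congʳ (-‿inverseˡ W)) ⟩
      U + (0# - Z)         ≈⟨ +-congˡ (+-identityˡ (- Z)) ⟩
      U - Z                ∎
      where
      Z : Carrier
      Z = select (does (z ≟ v)) x

  edgeNet-+ : ∀ {n} (u w : Fin n) x y v → edgeNet u w (x + y) v ≈ edgeNet u w x v + edgeNet u w y v
  edgeNet-+ u w x y v = begin
    select U (x + y) - select W (x + y)
      ≈⟨ +-cong (select-+ U x y) (-‿cong (select-+ W x y)) ⟩
    (select U x + select U y) - (select W x + select W y)
      ≈⟨ +-congˡ (-‿+-comm _ _) ⟨
    (select U x + select U y) + (- select W x - select W y)
      ≈⟨ interchange _ _ _ _ ⟩
    (select U x - select W x) + (select U y - select W y)
      ∎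
    where
    U W : Bool
    U = does (u ≟ v)
    W = does (w ≟ v)

  edgeNet-incident : ∀ {n} {u x w : Fin n} (p : u ≡ w ⊎ x ≡ w) y v →
                     edgeNet u x (signed (enters p) y) v ≈ edgeNet w (far p) y v
  edgeNet-incident               (inj₁ ≡.refl) y v = refl
  edgeNet-incident {u = u} {x} (inj₂ ≡.refl) y v = edgeNet-reverse x u y v

  net-cong : ∀ {m n} (s t : Fin m → Fin n) {a a′ : Fin m → Carrier} →
             (∀ e → a e ≈ a′ e) → ∀ v → net s t a v ≈ net s t a′ v
  net-cong s t same v = sum-cong-≋ λ e → edgeNet-cong (s e) (t e) v (same e)

  net-+ : ∀ {m n} (s t : Fin m → Fin n) (a b : Fin m → Carrier) v →
          net s t (λ e → a e + b e) v ≈ net s t a v + net s t b v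
  net-+ s t a b v = trans (sum-cong-≋ λ e → edgeNet-+ (s e) (t e) (a e) (b e) v)
    (∑-distrib-+ (λ e → edgeNet (s e) (t e) (a e) v) (λ e → edgeNet (s e) (t e) (b e) v))

  net-neg : ∀ {m n} (s t : Fin m → Fin n) (a : Fin m → Carrier) v →
            net s t (λ e → - a e) v ≈ - net s t a v
  net-neg s t a v = trans (sum-cong-≋ λ e → edgeNet-neg (s e) (t e) (a e) v)
    (sum-neg (λ e → edgeNet (s e) (t e) (a e) v))

  net-split : ∀ {m n} {s t : Fin m → Fin n} {a a′ : Fin m → Carrier} {i j : Fin m} →
              i ≢ j → (p : s j ≡ t i ⊎ t j ≡ t i) →
              (∀ e → e ≢ j → a e ≈ a′ e) → a j ≈ signed (enters p) (a′ i) →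
              ∀ v → net s t a v ≈ net s (split s t i j p) a′ v
  net-split {s = s} {t} {a} {a′} {i} {j} i≢j p same aj v = sum-cong-except₂ i≢j outside pair
    where
    t′ : Fin _ → Fin _
    t′ = split s t i j p
    outside : ∀ e → e ≢ i → e ≢ j → edgeNet (s e) (t e) (a e) v ≈ edgeNet (s e) (t′ e) (a′ e) v
    outside e e≢i e≢j = begin
      edgeNet (s e) (t e) (a e) v
        ≈⟨ edgeNet-cong (s e) (t e) v (same e e≢j) ⟩
      edgeNet (s e) (t e) (a′ e) v
        ≡⟨ ≡.cong (λ w → edgeNet (s e) w (a′ e) v) (split-other s t p e≢i e≢j) ⟨
      edgeNet (s e) (t′ e) (a′ e) v
        ∎
    pair : edgeNet (s i) (t i) (a i) v + edgeNet (s j) (t j) (a j) v ≈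
           edgeNet (s i) (t′ i) (a′ i) v + edgeNet (s j) (t′ j) (a′ j) v
    pair = begin
      edgeNet (s i) (t i) (a i) v + edgeNet (s j) (t j) (a j) v
        ≈⟨ +-cong (edgeNet-cong (s i) (t i) v (same i i≢j)) (edgeNet-cong (s j) (t j) v aj) ⟩
      edgeNet (s i) (t i) (a′ i) v + edgeNet (s j) (t j) (signed (enters p) (a′ i)) v
        ≈⟨ +-congˡ (edgeNet-incident p (a′ i) v) ⟩
      edgeNet (s i) (t i) (a′ i) v + edgeNet (t i) (far p) (a′ i) v
        ≈⟨ edgeNet-chain (s i) (t i) (a′ i) v (far p) ⟩
      edgeNet (s i) (far p) (a′ i) v
        ≈⟨ +-identityʳ _ ⟨
      edgeNet (s i) (far p) (a′ i) v + 0#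
        ≈⟨ +-congˡ (edgeNet-loop {u = s j} (a′ j) v ≡.refl) ⟨
      edgeNet (s i) (far p) (a′ i) v + edgeNet (s j) (s j) (a′ j) v
        ≡⟨ ≡.cong₂ (λ w z → edgeNet (s i) w (a′ i) v + edgeNet (s j) z (a′ j) v)
                   (split-i s t p i≢j) (split-j s t p) ⟨
      edgeNet (s i) (t′ i) (a′ i) v + edgeNet (s j) (t′ j) (a′ j) v
        ∎

module NetHom {a ℓa b ℓb} (A : AbelianGroup a ℓa) (B : AbelianGroup b ℓb) where
  private
    module A = AdditiveNotation A
    module B = AdditiveNotation B
    module NA = Net A
    module NB = Net B
  open GroupMorphisms (AbelianGroup.rawGroup A) (AbelianGroup.rawGroup B) public
  open B using (_≈_; refl; trans; +-cong; +-congˡ; -‿cong)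

  module _ {h : A.Carrier → B.Carrier} (hom : IsGroupHomomorphism h) where
    open IsGroupHomomorphism hom

    sum-hom : ∀ {n} (f : Fin n → A.Carrier) → h (FinSum.sum A f) ≈ FinSum.sum B (h ∘ f)
    sum-hom {zero}  f = ε-homo
    sum-hom {suc n} f = trans (homo _ _) (+-congˡ (sum-hom (f ∘ suc)))

    select-hom : ∀ c x → h (NA.select c x) ≈ NB.select c (h x)
    select-hom true  x = refl
    select-hom false x = ε-homo

    edgeNet-hom : ∀ {n} (u w : Fin n) x v → h (NA.edgeNet u w x v) ≈ NB.edgeNet u w (h x) v
    edgeNet-hom u w x v = trans (homo _ _)
      (+-cong (select-hom (does (u ≟ v)) x) (trans (⁻¹-homo _) (-‿cong (select-hom (does (w ≟ v)) x))))

    net-hom : ∀ {m n} (s t : Fin m → Fin n) (f : Fin m → A.Carrier) v →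
              h (NA.net s t f v) ≈ NB.net s t (h ∘ f) v
    net-hom s t f v = trans (sum-hom (λ e → NA.edgeNet (s e) (t e) (f e) v))
      (FinSum.sum-cong-≋ B λ e → edgeNet-hom (s e) (t e) (f e) v)

module IntegerCast {c ℓ} (A : Ring c ℓ) where
  open Ring A hiding (zero)
  open import Algebra.Properties.Ring A using (-0#≈0#; -‿+-comm; -‿involutive)
  open import Algebra.Properties.CommutativeSemigroup +-commutativeSemigroup using (interchange)
  open import Algebra.Properties.Monoid.Mult +-monoid using (×-homo-+) renaming (_×_ to _×ₙ_)
  open import Data.Nat.Properties using (+-suc)
  open import Data.Integer.Properties using ([1+m]⊖[1+n]≡m⊖n)
  open NetHom +-0-abelianGroup +-abelianGroup using (IsGroupHomomorphism)
  open import Relation.Binary.Reasoning.Setoid setoid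

  fromℤ : ℤ → Carrier
  fromℤ (+ n)    = n ×ₙ 1#
  fromℤ -[1+ n ] = - (suc n ×ₙ 1#)

  fromℤ-⊖ : ∀ m n → fromℤ (m ⊖ n) ≈ m ×ₙ 1# - n ×ₙ 1#
  fromℤ-⊖ zero    zero    = sym (-‿inverseʳ 0#)
  fromℤ-⊖ zero    (suc n) = sym (+-identityˡ _)
  fromℤ-⊖ (suc m) zero    = sym (trans (+-congˡ -0#≈0#) (+-identityʳ _))
  fromℤ-⊖ (suc m) (suc n) = begin
    fromℤ (suc m ⊖ suc n)  ≡⟨ ≡.cong fromℤ ([1+m]⊖[1+n]≡m⊖n m n) ⟩
    fromℤ (m ⊖ n)          ≈⟨ fromℤ-⊖ m n ⟩
    M - N                  ≈⟨ +-identityˡ _ ⟨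
    0# + (M - N)           ≈⟨ +-congʳ (-‿inverseʳ 1#) ⟨
    (1# - 1#) + (M - N)    ≈⟨ interchange 1# (- 1#) M (- N) ⟩
    (1# + M) + (- 1# - N)  ≈⟨ +-congˡ (-‿+-comm 1# N) ⟩
    (1# + M) - (1# + N)    ∎
    where
    M N : Carrier
    M = m ×ₙ 1#
    N = n ×ₙ 1#

  fromℤ-+ : ∀ x y → fromℤ (x ℤ.+ y) ≈ fromℤ x + fromℤ y
  fromℤ-+ (+ m)    (+ n)    = ×-homo-+ 1# m n
  fromℤ-+ (+ m)    -[1+ n ] = fromℤ-⊖ m (suc n)
  fromℤ-+ -[1+ m ] (+ n)    = trans (fromℤ-⊖ n (suc m)) (+-comm _ _)
  fromℤ-+ -[1+ m ] -[1+ n ] = begin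
    - (suc (suc (m ℕ.+ n)) ×ₙ 1#)      ≡⟨ ≡.cong (λ k → - (suc k ×ₙ 1#)) (+-suc m n) ⟨
    - ((suc m ℕ.+ suc n) ×ₙ 1#)        ≈⟨ -‿cong (×-homo-+ 1# (suc m) (suc n)) ⟩
    - (suc m ×ₙ 1# + suc n ×ₙ 1#)      ≈⟨ -‿+-comm _ _ ⟨
    - (suc m ×ₙ 1#) + - (suc n ×ₙ 1#)  ∎

  fromℤ-neg : ∀ x → fromℤ (ℤ.- x) ≈ - fromℤ x
  fromℤ-neg (+ zero)  = sym -0#≈0#
  fromℤ-neg (+ suc n) = refl
  fromℤ-neg -[1+ n ]  = sym (-‿involutive _)

  fromℤ-isGroupHomomorphism : IsGroupHomomorphism fromℤ
  fromℤ-isGroupHomomorphism = record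
    { isMonoidHomomorphism = record
      { isMagmaHomomorphism = record
        { isRelHomomorphism = record { cong = λ { ≡.refl → refl } }
        ; homo              = fromℤ-+
        }
      ; ε-homo = refl
      }
    ; ⁻¹-homo = fromℤ-neg
    }

module Parity where
  open import Data.Bool using (_xor_)
  open import Data.Bool.Properties using (xor-∧-commutativeRing; not-involutive; xor-same)
  open import Data.Integer.Properties using (neg-distrib-+)
  open import Data.Nat.Base using (⌊_/2⌋)
  open import Data.Nat.Properties using (+-suc)

  module 𝔽₂ = CommutativeRing xor-∧-commutativeRing
  module ℤNet = Net +-0-abelianGroup
  module 𝔽₂Net = Net 𝔽₂.+-abelianGroup
  module Cast₂ = IntegerCast 𝔽₂.ring

  parity : ℤ → Bool
  parity = Cast₂.fromℤ

  parity-+ : ∀ x y → parity (x ℤ.+ y) ≡ parity x xor parity y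
  parity-+ = Cast₂.fromℤ-+

  parity-neg : ∀ x → parity (ℤ.- x) ≡ parity x
  parity-neg = Cast₂.fromℤ-neg

  parity-cancel : ∀ x y → parity x ≡ parity y → parity (x ℤ.- y) ≡ false
  parity-cancel x y same = ≡.trans (parity-+ x (ℤ.- y))
    (≡.trans (≡.cong (parity x xor_) (≡.trans (parity-neg y) (≡.sym same))) (xor-same (parity x)))

  half : ℤ → ℤ
  half (+ n)    = + ⌊ n /2⌋
  half -[1+ n ] = ℤ.- + ⌊ suc n /2⌋

  ⌊n/2⌋-double : ∀ n → parity (+ n) ≡ false → ⌊ n /2⌋ ℕ.+ ⌊ n /2⌋ ≡ n
  ⌊n/2⌋-double zero          _    = ≡.refl
  ⌊n/2⌋-double (suc zero)    ()
  ⌊n/2⌋-double (suc (suc n)) even = ≡.cong suc (≡.trans (+-suc ⌊ n /2⌋ ⌊ n /2⌋)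
    (≡.cong suc (⌊n/2⌋-double n (≡.trans (≡.sym (not-involutive (parity (+ n)))) even))))

  half-double : ∀ x → parity x ≡ false → half x ℤ.+ half x ≡ x
  half-double (+ n)    even = ≡.cong +_ (⌊n/2⌋-double n even)
  half-double -[1+ n ] even = begin
    ℤ.- + k ℤ.+ ℤ.- + k  ≡⟨ neg-distrib-+ (+ k) (+ k) ⟨
    ℤ.- + (k ℕ.+ k)      ≡⟨ ≡.cong (λ z → ℤ.- + z) (⌊n/2⌋-double (suc n) even) ⟩
    -[1+ n ]             ∎
    where
    open ≡.≡-Reasoning
    k : ℕ
    k = ⌊ suc n /2⌋

module IntegerFlows where
  open Parity using (parity; parity-cancel; half; half-double; module ℤNet)
  open ℤNet using (net; net-+; net-neg; net-cong)

  record IsFlow {m n} (s t : Fin m → Fin n) (f : Fin m → ℤ) : Set where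
    constructor isFlow
    field net≡0 : ∀ v → net s t f v ≡ + 0
  open IsFlow public

  double≡0 : ∀ x → x ℤ.+ x ≡ + 0 → x ≡ + 0
  double≡0 (+ zero)  _  = ≡.refl
  double≡0 (+ suc n) ()
  double≡0 -[1+ n ]  ()

  module _ {m n} {s t : Fin m → Fin n} where

    flow-+ : ∀ {f g} → IsFlow s t f → IsFlow s t g → IsFlow s t (λ e → f e ℤ.+ g e)
    flow-+ {f} {g} f-flow g-flow = isFlow λ v →
      ≡.trans (net-+ s t f g v) (≡.cong₂ ℤ._+_ (net≡0 f-flow v) (net≡0 g-flow v))

    flow-− : ∀ {f g} → IsFlow s t f → IsFlow s t g → IsFlow s t (λ e → f e ℤ.- g e)
    flow-− {f} {g} f-flow g-flow = flow-+ f-flow (isFlow λ v →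
      ≡.trans (net-neg s t g v) (≡.cong ℤ.-_ (net≡0 g-flow v)))

    flow-half : ∀ {f} → (∀ e → parity (f e) ≡ false) → IsFlow s t f → IsFlow s t (half ∘ f)
    flow-half {f} even f-flow = isFlow λ v → double≡0 _ (begin
      net s t (half ∘ f) v ℤ.+ net s t (half ∘ f) v  ≡⟨ net-+ s t (half ∘ f) (half ∘ f) v ⟨
      net s t (λ e → half (f e) ℤ.+ half (f e)) v   ≡⟨ net-cong s t (λ e → half-double (f e) (even e)) v ⟩
      net s t f v                                   ≡⟨ net≡0 f-flow v ⟩
      + 0                                           ∎)
      where open ≡.≡-Reasoning

    halfFlow : ∀ {g a} → IsFlow s t g → IsFlow s t a → (∀ e → parity (a e) ≡ parity (g e)) →
               IsFlow s t (λ e → half (g e ℤ.- a e))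
    halfFlow {g} {a} g-flow a-flow same =
      flow-half (λ e → parity-cancel (g e) (a e) (≡.sym (same e))) (flow-− g-flow a-flow)

module EvenSubgraphs where
  open Parity
  open IntegerFlows using (IsFlow; isFlow; net≡0)
  open import Data.Bool.Properties as Bool using ()
  open import Data.Empty using (⊥-elim)
  open import Data.Fin.Properties using (any?)
  open import Data.Fin.Subset using (Subset; _∈_; _⊂_; ∣_∣)
  open import Data.Fin.Subset.Properties using (p⊂q⇒∣p∣<∣q∣)
  open import Data.Integer.Properties using (∣-i∣≡∣i∣)
  open import Data.Nat.Properties using (≤-refl; <-≤-trans)
  open import Data.Vec using (tabulate)
  open import Data.Vec.Properties using (lookup∘tabulate; lookup⇒[]=; []=⇒lookup)
  open import Function.Bundles using (Equivalence)
  open import Relation.Nullary using (¬_; Dec; yes; no; ¬?)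
  open import Relation.Nullary.Decidable using (dec-true; toWitness; isYes≗does; _×-dec_; _⊎-dec_)
  open import Relation.Unary using (Decidable)
  open ℤNet using (signed; edgeNet-0#; edgeNet-loop; net-split)
  open NetHom +-0-abelianGroup 𝔽₂.+-abelianGroup using (net-hom)

  Even : ∀ {m n} (s t : Fin m → Fin n) → (Fin m → Bool) → Set
  Even s t b = ∀ v → 𝔽₂Net.net s t b v ≡ false

  UnitLift : Bool → ℤ → Set
  UnitLift b x = ℤ.∣ x ∣ ℕ.≤ 1 × parity x ≡ b

  UnitFlowOn : ∀ {m n} (s t : Fin m → Fin n) → (Fin m → Bool) → Set
  UnitFlowOn s t b = Σ (Fin _ → ℤ) λ a → (∀ e → UnitLift (b e) (a e)) × IsFlow s t a

  module _ {m n} (s t : Fin m → Fin n) (b : Fin m → Bool) where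

    Active : Fin m → Set
    Active e = b e ≡ true × s e ≢ t e

    active? : Decidable Active
    active? e = (b e Bool.≟ true) ×-dec ¬? (s e ≟ t e)

    activeSet : Subset m
    activeSet = tabulate (λ e → does (active? e))

    ∈-activeSet⁺ : ∀ {e} → Active e → e ∈ activeSet
    ∈-activeSet⁺ {e} act = lookup⇒[]= e _ (≡.trans (lookup∘tabulate _ e) (dec-true (active? e) act))

    ∈-activeSet⁻ : ∀ {e} → e ∈ activeSet → Active e
    ∈-activeSet⁻ {e} e∈ = toWitness {a? = active? e} (Equivalence.from Bool.T-≡
      (≡.trans (isYes≗does (active? e)) (≡.trans (≡.sym (lookup∘tabulate _ e)) ([]=⇒lookup e∈))))

  loops⇒unitFlowOn : ∀ {m n} {s t : Fin m → Fin n} {b} → (∀ e → ¬ Active s t b e) → UnitFlowOn s t b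
  loops⇒unitFlowOn {s = s} {t} {b} inactive =
    (λ e → if b e then + 1 else + 0) , lift , isFlow λ v → FinSum.sum-zero +-0-abelianGroup (vanish v)
    where
    lift : ∀ e → UnitLift (b e) (if b e then + 1 else + 0)
    lift e with b e
    ... | true  = ≤-refl , ≡.refl
    ... | false = ℕ.z≤n , ≡.refl
    vanish : ∀ v e → ℤNet.edgeNet (s e) (t e) (if b e then + 1 else + 0) v ≡ + 0
    vanish v e with b e in be | s e ≟ t e
    ... | false | _      = edgeNet-0# (s e) (t e) v
    ... | true  | yes eq = edgeNet-loop (+ 1) v eq
    ... | true  | no ne  = ⊥-elim (inactive e (be , ne))

  lonely⇒odd : ∀ {m n} {s t : Fin m → Fin n} {b} {i} → Active s t b i →
               (∀ j → j ≢ i → Active s t b j → ¬ (s j ≡ t i ⊎ t j ≡ t i)) →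
               𝔽₂Net.net s t b (t i) ≡ true
  lonely⇒odd {s = s} {t} {b} {i} (bi , sᵢ≢tᵢ) lonely =
    ≡.trans (FinSum.sum-single 𝔽₂.+-abelianGroup i vanish) odd
    where
    vanish : ∀ e → e ≢ i → 𝔽₂Net.edgeNet (s e) (t e) (b e) (t i) ≡ false
    vanish e e≢i with b e in be
    ... | false = 𝔽₂Net.edgeNet-0# (s e) (t e) (t i)
    ... | true  = away (s e ≟ t e) (s e ≟ t i) (t e ≟ t i)
      where
      away : Dec (s e ≡ t e) → Dec (s e ≡ t i) → Dec (t e ≡ t i) →
             𝔽₂Net.edgeNet (s e) (t e) true (t i) ≡ false
      away (yes eq) _        _        = 𝔽₂Net.edgeNet-loop true (t i) eq
      away (no ne)  (yes eq) _        = ⊥-elim (lonely e e≢i (be , ne) (inj₁ eq))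
      away (no ne)  (no _)   (yes eq) = ⊥-elim (lonely e e≢i (be , ne) (inj₂ eq))
      away (no _)   (no ≢s)  (no ≢t)  = 𝔽₂Net.edgeNet-away true ≢s ≢t
    odd : 𝔽₂Net.edgeNet (s i) (t i) (b i) (t i) ≡ true
    odd rewrite bi | dec-false (s i ≟ t i) sᵢ≢tᵢ | dec-true (t i ≟ t i) ≡.refl = ≡.refl

  𝔽₂-signed : ∀ σ x → 𝔽₂Net.signed σ x ≡ x
  𝔽₂-signed true  x = ≡.refl
  𝔽₂-signed false x = ≡.refl

  UnitLift-signed : ∀ σ {c x} → UnitLift c x → UnitLift c (signed σ x)
  UnitLift-signed false lift = lift
  UnitLift-signed true {x = x} (bound , par) =
    ≡.subst (ℕ._≤ 1) (≡.sym (∣-i∣≡∣i∣ x)) bound , ≡.trans (parity-neg x) par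

  module _ {m n} {s t : Fin m → Fin n} {b : Fin m → Bool} {i j : Fin m}
           (i≢j : i ≢ j) (p : s j ≡ t i ⊎ t j ≡ t i) where

    split-even : b i ≡ true → b j ≡ true → Even s t b → Even s (split s t i j p) b
    split-even bi bj even v =
      ≡.trans (≡.sym (𝔽₂Net.net-split {s = s} {t} i≢j p (λ _ _ → ≡.refl) bj′ v)) (even v)
      where
      bj′ : b j ≡ 𝔽₂Net.signed (enters p) (b i)
      bj′ = ≡.trans bj (≡.trans (≡.sym bi) (≡.sym (𝔽₂-signed (enters p) (b i))))

    split-shrinks : Active s t b i → Active s t b j → activeSet s (split s t i j p) b ⊂ activeSet s t b
    split-shrinks act-i act-j =
      (λ e∈ → ∈-activeSet⁺ s t b (still-active (∈-activeSet⁻ s _ b e∈))) ,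
      j , ∈-activeSet⁺ s t b act-j , λ j∈ → proj₂ (∈-activeSet⁻ s _ b j∈) (≡.sym (split-j s t p))
      where
      still-active : ∀ {e} → Active s (split s t i j p) b e → Active s t b e
      still-active {e} (be , s≢t′) with e ≟ i | e ≟ j
      ... | yes ≡.refl | _          = act-i
      ... | no _       | yes ≡.refl = ⊥-elim (s≢t′ (≡.sym (split-j s t p)))
      ... | no e≢i     | no e≢j     =
        be , λ eq → s≢t′ (≡.trans eq (≡.sym (split-other s t p e≢i e≢j)))

    unsplit : b i ≡ true → b j ≡ true → UnitFlowOn s (split s t i j p) b → UnitFlowOn s t b
    unsplit bi bj (a′ , lift′ , flow′) =
      a , lift , isFlow λ v → ≡.trans (net-split {s = s} {t} i≢j p same a-j v) (net≡0 flow′ v)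
      where
      a : Fin m → ℤ
      a = updateAt a′ j (const (signed (enters p) (a′ i)))
      same : ∀ e → e ≢ j → a e ≡ a′ e
      same e e≢j = updateAt-minimal e j a′ e≢j
      a-j : a j ≡ signed (enters p) (a′ i)
      a-j = updateAt-updates j a′
      lift : ∀ e → UnitLift (b e) (a e)
      lift e with e ≟ j
      ... | yes ≡.refl rewrite a-j | bj =
        ≡.subst (λ c → UnitLift c (signed (enters p) (a′ i))) bi (UnitLift-signed (enters p) (lift′ i))
      ... | no e≢j rewrite same e e≢j = lift′ e

  unitFlowOn-< : ∀ {m n} k {s t : Fin m → Fin n} {b} → ∣ activeSet s t b ∣ ℕ.< k → Even s t b →
                 UnitFlowOn s t b
  unitFlowOn-< (suc k) {s} {t} {b} (ℕ.s≤s bound) even with any? (active? s t b)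
  ... | no none = loops⇒unitFlowOn (λ e act → none (e , act))
  ... | yes (i , act-i)
    with any? (λ j → ¬? (j ≟ i) ×-dec active? s t b j ×-dec (s j ≟ t i ⊎-dec t j ≟ t i))
  ...   | no lonely = ⊥-elim (true≢false (≡.trans (≡.sym odd) (even (t i))))
    where
    odd : 𝔽₂Net.net s t b (t i) ≡ true
    odd = lonely⇒odd act-i (λ j j≢i act-j p → lonely (j , j≢i , act-j , p))
    true≢false : true ≢ false
    true≢false ()
  ...   | yes (j , j≢i , act-j , p) =
    unsplit {s = s} {t} i≢j p (proj₁ act-i) (proj₁ act-j)
      (unitFlowOn-< k {s} {split s t i j p} {b}
        (<-≤-trans (p⊂q⇒∣p∣<∣q∣ (split-shrinks {s = s} {t} i≢j p act-i act-j)) bound)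
        (split-even {s = s} {t} i≢j p (proj₁ act-i) (proj₁ act-j) even))
    where
    i≢j : i ≢ j
    i≢j = j≢i ∘ ≡.sym

  even⇒unitFlowOn : ∀ {m n} {s t : Fin m → Fin n} {b} → Even s t b → UnitFlowOn s t b
  even⇒unitFlowOn {s = s} {t} {b} = unitFlowOn-< _ {s} {t} {b} ≤-refl

  roundFlow : ∀ {m n} {s t : Fin m → Fin n} {g} → IsFlow s t g → UnitFlowOn s t (parity ∘ g)
  roundFlow {s = s} {t} {g} g-flow = even⇒unitFlowOn {s = s} {t} {parity ∘ g} λ v →
    ≡.trans (≡.sym (net-hom Cast₂.fromℤ-isGroupHomomorphism s t g v)) (≡.cong parity (net≡0 g-flow v))

module GraphFlows (G : Graph) where
  open Parity using (module ℤNet)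
  open IntegerFlows using (IsFlow; isFlow; net≡0)
  open import Data.Bool using (_xor_)
  open ℤNet using (net; signed; edgeNet; edgeNet-reverse; edgeNet-0#)
  open FinSum +-0-abelianGroup using (sum; sum-sub; sum-cong-≋; sum-zero)

  Flow : Orientation G → (Fin (m G) → ℤ) → Set
  Flow D = IsFlow (tail G D) (head G D)

  sumℤ≡sum : ∀ {k} (f : Fin k → ℤ) → sumℤ f ≡ sum f
  sumℤ≡sum {zero}  f = ≡.refl
  sumℤ≡sum {suc k} f = ≡.cong (λ x → f zero ℤ.+ x) (sumℤ≡sum (f ∘ suc))

  netℤ≡net : ∀ D f v → netℤ G D f v ≡ net (tail G D) (head G D) f v
  netℤ≡net D f v =
    ≡.trans (≡.cong₂ ℤ._-_ (sumℤ≡sum out) (sumℤ≡sum in′)) (≡.sym (sum-sub out in′))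
    where
    out in′ : Fin (m G) → ℤ
    out e = if does (tail G D e ≟ v) then f e else + 0
    in′ e = if does (head G D e ≟ v) then f e else + 0

  nzFlow⇒flow : ∀ {k} D f → IsNZFlow k G D f → Flow D f
  nzFlow⇒flow D f (_ , netℤ≡0) = isFlow λ v → ≡.trans (≡.sym (netℤ≡net D f v)) (netℤ≡0 v)

  flow⇒nzFlow : ∀ {k D f} → (∀ e → 0 ℕ.< ℤ.∣ f e ∣ × ℤ.∣ f e ∣ ℕ.< k) → Flow D f →
                IsNZFlow k G D f
  flow⇒nzFlow {D = D} {f} bounds f-flow = bounds , λ v → ≡.trans (netℤ≡net D f v) (net≡0 f-flow v)

  flow-zero : ∀ D → Flow D (λ _ → + 0)
  flow-zero D = isFlow λ v → sum-zero λ e → edgeNet-0# (tail G D e) (head G D e) v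

  reorient : Orientation G → (Fin (m G) → Bool) → Orientation G
  reorient D σ e = σ e xor D e

  flow-reorient : ∀ D {f} σ → Flow D f → Flow (reorient D σ) (λ e → signed (σ e) (f e))
  flow-reorient D {f} σ f-flow = isFlow λ v →
    ≡.trans (sum-cong-≋ λ e → reversed v (σ e) (D e) (end₁ G e) (end₂ G e) (f e)) (net≡0 f-flow v)
    where
    reversed : ∀ v σ d (u w : Fin (n G)) x →
               edgeNet (if σ xor d then u else w) (if σ xor d then w else u) (signed σ x) v ≡
               edgeNet (if d then u else w) (if d then w else u) x v
    reversed v false d     u w x = ≡.refl
    reversed v true  true  u w x = edgeNet-reverse u w x v
    reversed v true  false u w x = edgeNet-reverse w u x v

module RealFieldProperties {c ℓ} (R : RealField c ℓ) where
  open RealField R hiding (zero) renaming (_≤_ to infix 4 _≤ᴿ_)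
  open import Algebra.Properties.Ring ring using (-0#≈0#; -‿involutive; -1*x≈-x)
  open import Algebra.Properties.Monoid.Mult +-monoid using () renaming (_×_ to _×ₙ_)
  open import Data.Empty using (⊥-elim)
  open import Relation.Binary.Reasoning.Setoid setoid
  open import Relation.Binary.Structures using (IsTotalOrder)
  open import Relation.Nullary using (¬_)
  open IsTotalOrder isTotalOrder using (total; antisym) renaming (trans to ≤-trans; reflexive to ≤-reflexive)
  open IntegerCast ring using (fromℤ)

  0≤1 : 0# ≤ᴿ 1#
  0≤1 with total 0# 1#
  ... | inj₁ 0≤1 = 0≤1
  ... | inj₂ 1≤0 = ≤-trans (*-nonneg 0≤-1 0≤-1) (≤-reflexive -1*-1≈1)
    where
    0≤-1 : 0# ≤ᴿ - 1#
    0≤-1 = ≤-trans (≤-reflexive (sym (-‿inverseʳ 1#)))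
             (≤-trans (+-monoˡ-≤ (- 1#) 1≤0) (≤-reflexive (+-identityˡ (- 1#))))
    -1*-1≈1 : - 1# * - 1# ≈ 1#
    -1*-1≈1 = trans (-1*x≈-x (- 1#)) (-‿involutive 1#)

  0≤n×1 : ∀ n → 0# ≤ᴿ n ×ₙ 1#
  1≤suc-n×1 : ∀ n → 1# ≤ᴿ suc n ×ₙ 1#
  0≤n×1 zero    = ≤-reflexive refl
  0≤n×1 (suc n) = ≤-trans 0≤1 (1≤suc-n×1 n)
  1≤suc-n×1 n = ≤-trans (≤-reflexive (sym (+-identityˡ 1#)))
                  (≤-trans (+-monoˡ-≤ 1# (0≤n×1 n)) (≤-reflexive (+-comm (n ×ₙ 1#) 1#)))

  suc-n×1≉0 : ∀ n → ¬ (suc n ×ₙ 1# ≈ 0#)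
  suc-n×1≉0 n eq = 0≉1 (antisym 0≤1 (≤-trans (1≤suc-n×1 n) (≤-reflexive eq)))

  fromℤ-injective₀ : ∀ x → fromℤ x ≈ 0# → x ≡ + 0
  fromℤ-injective₀ (+ zero)  _  = ≡.refl
  fromℤ-injective₀ (+ suc n) eq = ⊥-elim (suc-n×1≉0 n eq)
  fromℤ-injective₀ -[1+ n ]  eq =
    ⊥-elim (suc-n×1≉0 n (trans (sym (-‿involutive _)) (trans (-‿cong eq) -0#≈0#)))

  *-cancelˡ₀ : ∀ {x y} → ¬ (x ≈ 0#) → x * y ≈ 0# → y ≈ 0#
  *-cancelˡ₀ {x} {y} x≉0 xy≈0 with inverse x x≉0
  ... | x⁻¹ , x*x⁻¹≈1 = begin
    y              ≈⟨ *-identityˡ y ⟨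
    1# * y         ≈⟨ *-congʳ x*x⁻¹≈1 ⟨
    (x * x⁻¹) * y  ≈⟨ *-congʳ (*-comm x x⁻¹) ⟩
    (x⁻¹ * x) * y  ≈⟨ *-assoc x⁻¹ x y ⟩
    x⁻¹ * (x * y)  ≈⟨ *-congˡ xy≈0 ⟩
    x⁻¹ * 0#       ≈⟨ zeroʳ x⁻¹ ⟩
    0#             ∎

module VectorFlows {c ℓ} (R : RealField c ℓ) (G : Graph) {d : ℕ} (P₁ P₂ : Vecᴿ R d) where
  open RealField R hiding (zero; _≤_)
  open import Algebra.Properties.Ring ring using (-‿distribˡ-*)
  open import Data.Empty using (⊥-elim)
  open import Data.Product using (map)
  open import Relation.Binary.Reasoning.Setoid setoid
  open import Relation.Nullary using (yes; no)
  open IntegerCast ring using (fromℤ; fromℤ-isGroupHomomorphism)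
  open RealFieldProperties R using (fromℤ-injective₀; *-cancelˡ₀)
  open IntegerFlows using (isFlow; net≡0)
  open GraphFlows G using (Flow; reorient; flow-reorient)
  open Parity using (module ℤNet)
  open ℤNet using (signed)
  open FinSum +-abelianGroup using (sum; sum-sub)
  module ℝNet = Net +-abelianGroup
  open NetHom +-abelianGroup +-abelianGroup using (IsGroupHomomorphism) renaming (net-hom to ℝ-net-hom)
  open NetHom +-0-abelianGroup +-abelianGroup using () renaming (net-hom to ℤ-net-hom)

  comb : ℤ → ℤ → Vecᴿ R d
  comb x y i = fromℤ x * P₁ i + fromℤ y * P₂ i

  fromℤ1* : ∀ x → fromℤ (+ 1) * x ≈ x
  fromℤ1* x = trans (*-congʳ (+-identityʳ 1#)) (*-identityˡ x)

  comb-0 : _≈ᵛ_ R (comb (+ 0) (+ 0)) (0ᵛ R)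
  comb-0 i = trans (+-cong (zeroˡ (P₁ i)) (zeroˡ (P₂ i))) (+-identityʳ 0#)

  comb-10 : _≈ᵛ_ R (comb (+ 1) (+ 0)) P₁
  comb-10 i = trans (+-cong (fromℤ1* (P₁ i)) (zeroˡ (P₂ i))) (+-identityʳ (P₁ i))

  comb-01 : _≈ᵛ_ R (comb (+ 0) (+ 1)) P₂
  comb-01 i = trans (+-cong (zeroˡ (P₁ i)) (fromℤ1* (P₂ i))) (+-identityˡ (P₂ i))

  comb-11 : _≈ᵛ_ R (comb (+ 1) (+ 1)) (_+ᵛ_ R P₁ P₂)
  comb-11 i = +-cong (fromℤ1* (P₁ i)) (fromℤ1* (P₂ i))

  comb-1-1 : _≈ᵛ_ R (comb (+ 1) -[1+ 0 ]) (_-ᵛ_ R P₁ P₂)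
  comb-1-1 i = +-cong (fromℤ1* (P₁ i)) (trans (sym (-‿distribˡ-* _ (P₂ i))) (-‿cong (fromℤ1* (P₂ i))))

  comb-injective₀ : NonCollinear R P₁ P₂ → ∀ x y → _≈ᵛ_ R (comb x y) (0ᵛ R) → x ≡ + 0 × y ≡ + 0
  comb-injective₀ nc x y eq = map (fromℤ-injective₀ x) (fromℤ-injective₀ y) (nc (fromℤ x) (fromℤ y) eq)

  comb-injectiveˡ₀ : NonzeroVec R P₁ → ∀ x {y} → y ≡ + 0 → _≈ᵛ_ R (comb x y) (0ᵛ R) → x ≡ + 0
  comb-injectiveˡ₀ P₁≉0 x ≡.refl eq with x ℤ.≟ + 0
  ... | yes x≡0 = x≡0
  ... | no  x≢0 = ⊥-elim (P₁≉0 λ i → *-cancelˡ₀ (x≢0 ∘ fromℤ-injective₀ x)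
                    (trans (sym (+-identityʳ _)) (trans (+-congˡ (sym (zeroˡ (P₂ i)))) (eq i))))

  sumᴿ≡sum : ∀ {k} (f : Fin k → Carrier) → sumᴿ R f ≡ sum f
  sumᴿ≡sum {zero}  f = ≡.refl
  sumᴿ≡sum {suc k} f = ≡.cong (λ x → f zero + x) (sumᴿ≡sum (f ∘ suc))

  netᴿ≈net : ∀ D (F : Fin (m G) → Vecᴿ R d) v i →
             netᴿ R G D F v i ≈ ℝNet.net (tail G D) (head G D) (λ e → F e i) v
  netᴿ≈net D F v i =
    trans (reflexive (≡.cong₂ _-_ (sumᴿ≡sum out) (sumᴿ≡sum in′))) (sym (sum-sub out in′))
    where
    out in′ : Fin (m G) → Carrier
    out e = if does (tail G D e ≟ v) then F e i else 0#
    in′ e = if does (head G D e ≟ v) then F e i else 0#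

  netᴿ-cong : ∀ D {F F′ : Fin (m G) → Vecᴿ R d} → (∀ e → _≈ᵛ_ R (F e) (F′ e)) →
              ∀ v → _≈ᵛ_ R (netᴿ R G D F v) (netᴿ R G D F′ v)
  netᴿ-cong D {F} {F′} F≈F′ v i = begin
    netᴿ R G D F v i                                  ≈⟨ netᴿ≈net D F v i ⟩
    ℝNet.net (tail G D) (head G D) (λ e → F e i) v
      ≈⟨ ℝNet.net-cong (tail G D) (head G D) (λ e → F≈F′ e i) v ⟩
    ℝNet.net (tail G D) (head G D) (λ e → F′ e i) v  ≈⟨ netᴿ≈net D F′ v i ⟨
    netᴿ R G D F′ v i                                 ∎

  *-isGroupHomomorphism : ∀ x → IsGroupHomomorphism (_* x)
  *-isGroupHomomorphism x = record
    { isMonoidHomomorphism = record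
      { isMagmaHomomorphism = record
        { isRelHomomorphism = record { cong = *-congʳ }
        ; homo              = λ y z → distribʳ x y z
        }
      ; ε-homo = zeroˡ x
      }
    ; ⁻¹-homo = λ y → sym (-‿distribˡ-* y x)
    }

  module _ (D : Orientation G) where
    private
      s t : Fin (m G) → Fin (n G)
      s = tail G D
      t = head G D

    net-fromℤ* : ∀ f x v → ℝNet.net s t (λ e → fromℤ (f e) * x) v ≈ fromℤ (ℤNet.net s t f v) * x
    net-fromℤ* f x v = sym (trans (*-congʳ (ℤ-net-hom fromℤ-isGroupHomomorphism s t f v))
                                  (ℝ-net-hom (*-isGroupHomomorphism x) s t (fromℤ ∘ f) v))

    netᴿ-comb : ∀ p q v →
                _≈ᵛ_ R (netᴿ R G D (λ e → comb (p e) (q e)) v) (comb (ℤNet.net s t p v) (ℤNet.net s t q v))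
    netᴿ-comb p q v i = begin
      netᴿ R G D (λ e → comb (p e) (q e)) v i
        ≈⟨ netᴿ≈net D (λ e → comb (p e) (q e)) v i ⟩
      ℝNet.net s t (λ e → fromℤ (p e) * P₁ i + fromℤ (q e) * P₂ i) v
        ≈⟨ ℝNet.net-+ s t (λ e → fromℤ (p e) * P₁ i) (λ e → fromℤ (q e) * P₂ i) v ⟩
      ℝNet.net s t (λ e → fromℤ (p e) * P₁ i) v + ℝNet.net s t (λ e → fromℤ (q e) * P₂ i) v
        ≈⟨ +-cong (net-fromℤ* p (P₁ i) v) (net-fromℤ* q (P₂ i) v) ⟩
      comb (ℤNet.net s t p v) (ℤNet.net s t q v) i
        ∎

    comb-net≈0 : ∀ {Ω : Vecᴿ R d → Set ℓ} {F} → IsVecFlow R Ω G D F → ∀ {p q} →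
                 (∀ e → _≈ᵛ_ R (F e) (comb (p e) (q e))) →
                 ∀ v → _≈ᵛ_ R (comb (ℤNet.net s t p v) (ℤNet.net s t q v)) (0ᵛ R)
    comb-net≈0 {F = F} (_ , F-flow) {p} {q} F≈comb v i = begin
      comb (ℤNet.net s t p v) (ℤNet.net s t q v) i  ≈⟨ netᴿ-comb p q v i ⟨
      netᴿ R G D (λ e → comb (p e) (q e)) v i       ≈⟨ netᴿ-cong D F≈comb v i ⟨
      netᴿ R G D F v i                              ≈⟨ F-flow v i ⟩
      0#                                            ∎

  vecFlow-from-flows : ∀ (Ω : Vecᴿ R d → Set ℓ) D {p q} → Flow D p → Flow D q →
                       (∀ e → Σ Bool λ σ → Ω (comb (signed σ (p e)) (signed σ (q e)))) →
                       HasVecFlow R Ω G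
  vecFlow-from-flows Ω D {p} {q} p-flow q-flow choose =
    D′ , (λ e → comb (p′ e) (q′ e)) , (λ e → proj₂ (choose e)) , λ v i → begin
      netᴿ R G D′ (λ e → comb (p′ e) (q′ e)) v i
        ≈⟨ netᴿ-comb D′ p′ q′ v i ⟩
      comb (ℤNet.net (tail G D′) (head G D′) p′ v) (ℤNet.net (tail G D′) (head G D′) q′ v) i
        ≡⟨ ≡.cong₂ (λ x y → comb x y i) (net≡0 (flow-reorient D σ p-flow) v)
                                         (net≡0 (flow-reorient D σ q-flow) v) ⟩
      comb (+ 0) (+ 0) i
        ≈⟨ comb-0 i ⟩
      0#
        ∎
    where
    σ : Fin (m G) → Bool
    σ e = proj₁ (choose e)
    D′ : Orientation G
    D′ = reorient D σ
    p′ q′ : Fin (m G) → ℤ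
    p′ e = signed (σ e) (p e)
    q′ e = signed (σ e) (q e)

  flows-from-vecFlow : NonCollinear R P₁ P₂ → ∀ {Ω : Vecᴿ R d → Set ℓ} {S : ℤ → ℤ → Set} →
    (∀ {x} → Ω x → Σ ℤ λ p → Σ ℤ λ q → _≈ᵛ_ R x (comb p q) × S p q) → HasVecFlow R Ω G →
    Σ (Orientation G) λ D → Σ (Fin (m G) → ℤ) λ p → Σ (Fin (m G) → ℤ) λ q →
      Flow D p × Flow D q × (∀ e → S (p e) (q e))
  flows-from-vecFlow nc {Ω} coeffs (D , F , F-flow@(F∈Ω , _)) =
    D , p , q , isFlow (proj₁ ∘ nets≡0) , isFlow (proj₂ ∘ nets≡0) ,
    λ e → proj₂ (proj₂ (proj₂ (coeffs (F∈Ω e))))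
    where
    p q : Fin (m G) → ℤ
    p e = proj₁ (coeffs (F∈Ω e))
    q e = proj₁ (proj₂ (coeffs (F∈Ω e)))
    nets≡0 : ∀ v → ℤNet.net (tail G D) (head G D) p v ≡ + 0 × ℤNet.net (tail G D) (head G D) q v ≡ + 0
    nets≡0 v = comb-injective₀ nc _ _
      (comb-net≈0 D {Ω = Ω} {F} F-flow {p} {q} (λ e → proj₁ (proj₂ (proj₂ (coeffs (F∈Ω e))))) v)

module _ {c ℓ} (R : RealField c ℓ) (G : Graph) {d : ℕ} where
  open import Data.Empty using (⊥-elim)
  open import Data.Nat using (_<_; z≤n; s≤s)
  open import Function.Bundles using (mk⇔)
  open import Relation.Nullary using (¬_)
  open RealField R using (trans; sym)
  open Parity using (parity; half; module ℤNet)
  open ℤNet using (signed)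
  open IntegerFlows using (isFlow; net≡0; flow-+; halfFlow)
  open EvenSubgraphs using (UnitLift; roundFlow)
  open GraphFlows G using (Flow; nzFlow⇒flow; flow⇒nzFlow; flow-zero)

  module _ (P : Vecᴿ R d) (P≉0 : NonzeroVec R P) where
    open VectorFlows R G P P

    Ω₁-sign : ∀ x → 0 < ℤ.∣ x ∣ × ℤ.∣ x ∣ < 2 →
              Σ Bool λ σ → Ω₁ R P (comb (signed σ x) (signed σ (+ 0)))
    Ω₁-sign (+ 1)           _                  = false , comb-10
    Ω₁-sign -[1+ 0 ]        _                  = true  , comb-10
    Ω₁-sign (+ 0)           (() , _)
    Ω₁-sign (+ suc (suc n)) (_ , s≤s (s≤s ()))
    Ω₁-sign -[1+ suc n ]    (_ , s≤s (s≤s ()))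

    2-flow⇔Ω₁-flow : HasNZFlow 2 G ⇔ HasVecFlow R (Ω₁ R P) G
    2-flow⇔Ω₁-flow = mk⇔ to from
      where
      to : HasNZFlow 2 G → HasVecFlow R (Ω₁ R P) G
      to (D , g , g-nz) =
        vecFlow-from-flows (Ω₁ R P) D (nzFlow⇒flow D g g-nz) (flow-zero D) λ e →
          Ω₁-sign (g e) (proj₁ g-nz e)
      from : HasVecFlow R (Ω₁ R P) G → HasNZFlow 2 G
      from (D , F , F-flow@(F≈P , _)) = D , one , flow⇒nzFlow (λ _ → s≤s z≤n , s≤s (s≤s z≤n)) one-flow
        where
        one : Fin (m G) → ℤ
        one _ = + 1
        one-flow : Flow D one
        one-flow = isFlow λ v → comb-injectiveˡ₀ P≉0 _ (net≡0 (flow-zero D) v)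
          (comb-net≈0 D {Ω = Ω₁ R P} F-flow {one} {λ _ → + 0} (λ e i → trans (F≈P e i) (sym (comb-10 i))) v)

  module _ (P₁ P₂ : Vecᴿ R d) (nc : NonCollinear R P₁ P₂) where
    open VectorFlows R G P₁ P₂

    Ω₃-sign : ∀ x y → 0 < ℤ.∣ x ∣ × ℤ.∣ x ∣ < 3 → UnitLift (parity x) y →
              let p = half (x ℤ.- y) in Σ Bool λ σ → Ω₃ R P₁ P₂ (comb (signed σ p) (signed σ (p ℤ.+ y)))
    Ω₃-sign (+ 1)    (+ 1)    _ _ = false , inj₂ (inj₁ comb-01)
    Ω₃-sign (+ 1)    -[1+ 0 ] _ _ = false , inj₁ comb-10
    Ω₃-sign (+ 2)    (+ 0)    _ _ = false , inj₂ (inj₂ comb-11)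
    Ω₃-sign -[1+ 0 ] (+ 1)    _ _ = true  , inj₁ comb-10
    Ω₃-sign -[1+ 0 ] -[1+ 0 ] _ _ = true  , inj₂ (inj₁ comb-01)
    Ω₃-sign -[1+ 1 ] (+ 0)    _ _ = true  , inj₂ (inj₂ comb-11)
    Ω₃-sign (+ 1)    (+ 0)    _ (_ , ())
    Ω₃-sign (+ 2)    (+ 1)    _ (_ , ())
    Ω₃-sign (+ 2)    -[1+ 0 ] _ (_ , ())
    Ω₃-sign -[1+ 0 ] (+ 0)    _ (_ , ())
    Ω₃-sign -[1+ 1 ] (+ 1)    _ (_ , ())
    Ω₃-sign -[1+ 1 ] -[1+ 0 ] _ (_ , ())
    Ω₃-sign x (+ suc (suc n)) _ (s≤s () , _)
    Ω₃-sign x -[1+ suc n ]    _ (s≤s () , _)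
    Ω₃-sign (+ 0)                 y (() , _) _
    Ω₃-sign (+ suc (suc (suc n))) y (_ , s≤s (s≤s (s≤s ()))) _
    Ω₃-sign -[1+ suc (suc n) ]    y (_ , s≤s (s≤s (s≤s ()))) _

    Ω₃-coeffs : ∀ {x} → Ω₃ R P₁ P₂ x → Σ ℤ λ p → Σ ℤ λ q →
                _≈ᵛ_ R x (comb p q) × (0 < ℤ.∣ p ℤ.+ q ∣ × ℤ.∣ p ℤ.+ q ∣ < 3)
    Ω₃-coeffs (inj₁ x≈P₁) =
      + 1 , + 0 , (λ i → trans (x≈P₁ i) (sym (comb-10 i))) , s≤s z≤n , s≤s (s≤s z≤n)
    Ω₃-coeffs (inj₂ (inj₁ x≈P₂)) =
      + 0 , + 1 , (λ i → trans (x≈P₂ i) (sym (comb-01 i))) , s≤s z≤n , s≤s (s≤s z≤n)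
    Ω₃-coeffs (inj₂ (inj₂ x≈P₁+P₂)) =
      + 1 , + 1 , (λ i → trans (x≈P₁+P₂ i) (sym (comb-11 i))) , s≤s z≤n , s≤s (s≤s (s≤s z≤n))

    3-flow⇔Ω₃-flow : HasNZFlow 3 G ⇔ HasVecFlow R (Ω₃ R P₁ P₂) G
    3-flow⇔Ω₃-flow = mk⇔ to from
      where
      to : HasNZFlow 3 G → HasVecFlow R (Ω₃ R P₁ P₂) G
      to (D , g , g-nz) =
        let g-flow : Flow D g
            g-flow = nzFlow⇒flow D g g-nz
            (a , a-lift , a-flow) = roundFlow g-flow
            p-flow : Flow D (λ e → half (g e ℤ.- a e))
            p-flow = halfFlow g-flow a-flow (proj₂ ∘ a-lift)
        in  vecFlow-from-flows (Ω₃ R P₁ P₂) D p-flow (flow-+ p-flow a-flow) λ e →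
              Ω₃-sign (g e) (a e) (proj₁ g-nz e) (a-lift e)
      from : HasVecFlow R (Ω₃ R P₁ P₂) G → HasNZFlow 3 G
      from vf =
        let (D , p , q , p-flow , q-flow , bounds) = flows-from-vecFlow nc Ω₃-coeffs vf
        in  D , _ , flow⇒nzFlow bounds (flow-+ p-flow q-flow)

    Ω₄-sign : ∀ y z → ℤ.∣ y ∣ ℕ.≤ 1 → ℤ.∣ z ∣ ℕ.≤ 1 → ¬ (y ≡ + 0 × z ≡ + 0) →
              Σ Bool λ σ → Ω₄ R P₁ P₂ (comb (signed σ y) (signed σ z))
    Ω₄-sign (+ 1)    (+ 0)    _ _ _ = false , inj₁ comb-10
    Ω₄-sign (+ 0)    (+ 1)    _ _ _ = false , inj₂ (inj₁ comb-01)
    Ω₄-sign (+ 1)    (+ 1)    _ _ _ = false , inj₂ (inj₂ (inj₁ comb-11))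
    Ω₄-sign (+ 1)    -[1+ 0 ] _ _ _ = false , inj₂ (inj₂ (inj₂ comb-1-1))
    Ω₄-sign -[1+ 0 ] (+ 0)    _ _ _ = true  , inj₁ comb-10
    Ω₄-sign (+ 0)    -[1+ 0 ] _ _ _ = true  , inj₂ (inj₁ comb-01)
    Ω₄-sign -[1+ 0 ] -[1+ 0 ] _ _ _ = true  , inj₂ (inj₂ (inj₁ comb-11))
    Ω₄-sign -[1+ 0 ] (+ 1)    _ _ _ = true  , inj₂ (inj₂ (inj₂ comb-1-1))
    Ω₄-sign (+ 0)    (+ 0)    _ _ nonzero = ⊥-elim (nonzero (≡.refl , ≡.refl))
    Ω₄-sign (+ suc (suc n)) z (s≤s ()) _ _
    Ω₄-sign -[1+ suc n ]    z (s≤s ()) _ _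
    Ω₄-sign y (+ suc (suc n)) _ (s≤s ()) _
    Ω₄-sign y -[1+ suc n ]    _ (s≤s ()) _

    -- x = y + 2 half (x - y) and half (x - y) ≡ z (mod 2), so y = z = 0 would make 4 divide x.
    lifts-nonzero : ∀ x {y z} → 0 < ℤ.∣ x ∣ × ℤ.∣ x ∣ < 4 → parity y ≡ parity x →
                    parity z ≡ parity (half (x ℤ.- y)) → ¬ (y ≡ + 0 × z ≡ + 0)
    lifts-nonzero (+ 0)    (() , _) _ _ _
    lifts-nonzero (+ 1)    _ () _ (≡.refl , ≡.refl)
    lifts-nonzero (+ 2)    _ _ () (≡.refl , ≡.refl)
    lifts-nonzero (+ 3)    _ () _ (≡.refl , ≡.refl)
    lifts-nonzero -[1+ 0 ] _ () _ (≡.refl , ≡.refl)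
    lifts-nonzero -[1+ 1 ] _ _ () (≡.refl , ≡.refl)
    lifts-nonzero -[1+ 2 ] _ () _ (≡.refl , ≡.refl)
    lifts-nonzero (+ suc (suc (suc (suc n)))) (_ , s≤s (s≤s (s≤s (s≤s ())))) _ _ _
    lifts-nonzero -[1+ suc (suc (suc n)) ]    (_ , s≤s (s≤s (s≤s (s≤s ())))) _ _ _

    Ω₄-coeffs : ∀ {x} → Ω₄ R P₁ P₂ x → Σ ℤ λ p → Σ ℤ λ q →
                _≈ᵛ_ R x (comb p q) × (0 < ℤ.∣ p ℤ.+ (q ℤ.+ q) ∣ × ℤ.∣ p ℤ.+ (q ℤ.+ q) ∣ < 4)
    Ω₄-coeffs (inj₁ x≈P₁) =
      + 1 , + 0 , (λ i → trans (x≈P₁ i) (sym (comb-10 i))) , s≤s z≤n , s≤s (s≤s z≤n)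
    Ω₄-coeffs (inj₂ (inj₁ x≈P₂)) =
      + 0 , + 1 , (λ i → trans (x≈P₂ i) (sym (comb-01 i))) , s≤s z≤n , s≤s (s≤s (s≤s z≤n))
    Ω₄-coeffs (inj₂ (inj₂ (inj₁ x≈P₁+P₂))) =
      + 1 , + 1 , (λ i → trans (x≈P₁+P₂ i) (sym (comb-11 i))) , s≤s z≤n , s≤s (s≤s (s≤s (s≤s z≤n)))
    Ω₄-coeffs (inj₂ (inj₂ (inj₂ x≈P₁-P₂))) =
      + 1 , -[1+ 0 ] , (λ i → trans (x≈P₁-P₂ i) (sym (comb-1-1 i))) , s≤s z≤n , s≤s (s≤s z≤n)

    4-flow⇔Ω₄-flow : HasNZFlow 4 G ⇔ HasVecFlow R (Ω₄ R P₁ P₂) G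
    4-flow⇔Ω₄-flow = mk⇔ to from
      where
      to : HasNZFlow 4 G → HasVecFlow R (Ω₄ R P₁ P₂) G
      to (D , g , g-nz) =
        let g-flow : Flow D g
            g-flow = nzFlow⇒flow D g g-nz
            (a , a-lift , a-flow) = roundFlow g-flow
            (c , c-lift , c-flow) = roundFlow (halfFlow g-flow a-flow (proj₂ ∘ a-lift))
        in  vecFlow-from-flows (Ω₄ R P₁ P₂) D a-flow c-flow λ e →
              Ω₄-sign (a e) (c e) (proj₁ (a-lift e)) (proj₁ (c-lift e))
                (lifts-nonzero (g e) (proj₁ g-nz e) (proj₂ (a-lift e)) (proj₂ (c-lift e)))
      from : HasVecFlow R (Ω₄ R P₁ P₂) G → HasNZFlow 4 G
      from vf =
        let (D , p , q , p-flow , q-flow , bounds) = flows-from-vecFlow nc Ω₄-coeffs vf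
        in  D , _ , flow⇒nzFlow bounds (flow-+ p-flow (flow-+ q-flow q-flow))

lemma2p2 : ∀ {c ℓ} (R : RealField c ℓ) (G : Graph) → Bridgeless G →
    (d : ℕ) → 2 ≤ d →
    (P P₁ P₂ : Vecᴿ R d) → NonzeroVec R P → NonCollinear R P₁ P₂ →
    (HasNZFlow 2 G ⇔ HasVecFlow R (Ω₁ R P) G)
    × (HasNZFlow 3 G ⇔ HasVecFlow R (Ω₃ R P₁ P₂) G)
    × (HasNZFlow 4 G ⇔ HasVecFlow R (Ω₄ R P₁ P₂) G)
lemma2p2 R G _ d _ P P₁ P₂ P≉0 P₁∦P₂ =
  2-flow⇔Ω₁-flow R G P P≉0 ,
  3-flow⇔Ω₃-flow R G P₁ P₂ P₁∦P₂ ,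
  4-flow⇔Ω₄-flow R G P₁ P₂ P₁∦P₂
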